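{- For each integer $\ell\ge1$, let $L_\ell^{\mathrm{int}}=\{w\in\{0,1\}^*\mid |w|_0=|w|_1=2\ell,\ \exists k,m\in\{1,\dots,\ell\}:\ \delta_{k,m}^{2\ell}(w)\in\{0101,1010,0110,1001\}\}$. Then $L_\ell^{\mathrm{int}}$ is $2\ell$-uniform and $\mathcal{G}_{L_\ell^{\mathrm{int}}}$ is exactly the class of $\ell$-interval graphs.
   Context: $|w|_a$ is the number of occurrences of letter $a$ in $w$; a binary word is $k$-uniform if it has exactly $k$ occurrences of $0$ and of $1$. For $\ell,d\ge1$ and $k,m\in\{1,\dots,\ell\}$, $\delta_{k,m}^{2\ell\to 2d}$ maps a $2\ell$-uniform binary word $w$ to the word obtained by deleting all occurrences of $0$ except the $(2k-1)$-st up to the $2(k-1+d)$-th occurrence of $0$, and all occurrences of $1$ except the $(2m-1)$-st up to the $2(m-1+d)$-th occurrence of $1$; $\delta_{k,m}^{2\ell}$ means $\delta_{k,m}^{2\ell\to2}$ (keeping the $(2k-1)$-st and $2k$-th $0$ and the $(2m-1)$-st and $2m$-th $1$). For a word $w$ and distinct letters $a,b$, $h_{a,b}(w)$ is obtained by replacing $a$ by $0$, $b$ by $1$ and deleting all other letters. For a language $L\subseteq\{0,1\}^*$ closed under exchanging $0$ and $1$ and a word $w$ with set of letters $V$, $G(L,w)$ is the graph on $V$ where distinct $u,v$ are adjacent iff $h_{u,v}(w)\in L$; $\mathcal{G}_L$ is the class of graphs isomorphic to some $G(L,w)$. A graph is an $\ell$-interval graph if each vertex $v$ can be assigned a union $f(v)$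 of $\ell$ closed real intervals such that distinct $u,v$ are adjacent iff $f(u)\cap f(v)\neq\emptyset$.
   Formalization: The closed intervals in the definition of ℓ-interval graphs have rational rather than real endpoints, and the common point of two such intervals is also taken among the rationals. -}

module Defs where

open import Data.Bool using (Bool; true; false; if_then_else_; _∧_)
open import Data.Nat using (ℕ; zero; suc; _+_; _*_; _∸_; _≤_; _≤ᵇ_)
open import Data.Nat.Properties using (_≟_)
open import Data.List using (List; []; _∷_)
open import Data.List.Membership.Propositional using (_∈_)
open import Data.Fin using (Fin)
open import Data.Product using (Σ; ∃; ∃-syntax; _×_; _,_)
open import Data.Sum using (_⊎_)
open import Relation.Nullary using (¬_; yes; no)
open import Relation.Binary.PropositionalEquality using (_≡_; _≢_)
open import Function.Definitions using (Injective)
open import Function.Bundles using (_⇔_)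
open import Data.Rational using (ℚ) renaming (_≤_ to _≤ℚ_)

-- Binary words: letter 0 is false, letter 1 is true.
BWord : Set
BWord = List Bool

count : Bool → BWord → ℕ
count a [] = 0
count a (b ∷ w) = if eqB a b then suc (count a w) else count a w
  where
  eqB : Bool → Bool → Bool
  eqB false false = true
  eqB true true = true
  eqB _ _ = false

Uniform : ℕ → BWord → Set
Uniform k w = (count false w ≡ k) × (count true w ≡ k)

UniformLang : ℕ → (BWord → Set) → Set
UniformLang k L = ∀ w → L w → Uniform k w

-- keep the occurrences of 0 whose (1-based) index lies in [lo0, hi0] and
-- the occurrences of 1 whose index lies in [lo1, hi1]; c0, c1 count the
-- occurrences of 0 resp. 1 already read.
select : ℕ → ℕ → ℕ → ℕ → ℕ → ℕ → BWord → BWord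
select lo0 hi0 lo1 hi1 c0 c1 [] = []
select lo0 hi0 lo1 hi1 c0 c1 (false ∷ w) =
  if (lo0 ≤ᵇ suc c0) ∧ (suc c0 ≤ᵇ hi0)
  then false ∷ select lo0 hi0 lo1 hi1 (suc c0) c1 w
  else select lo0 hi0 lo1 hi1 (suc c0) c1 w
select lo0 hi0 lo1 hi1 c0 c1 (true ∷ w) =
  if (lo1 ≤ᵇ suc c1) ∧ (suc c1 ≤ᵇ hi1)
  then true ∷ select lo0 hi0 lo1 hi1 c0 (suc c1) w
  else select lo0 hi0 lo1 hi1 c0 (suc c1) w

-- δ_{k,m}^{2ℓ→2d}: keep the (2k-1)-st .. 2(k-1+d)-th 0 and the
-- (2m-1)-st .. 2(m-1+d)-th 1 (ℓ only constrains the intended domain).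
δ : (ℓ d k m : ℕ) → BWord → BWord
δ ℓ d k m = select (2 * k ∸ 1) (2 * (k ∸ 1 + d)) (2 * m ∸ 1) (2 * (m ∸ 1 + d)) 0 0

δ₂ : (ℓ k m : ℕ) → BWord → BWord
δ₂ ℓ k m = δ ℓ 1 k m

w0101 w1010 w0110 w1001 : BWord
w0101 = false ∷ true ∷ false ∷ true ∷ []
w1010 = true ∷ false ∷ true ∷ false ∷ []
w0110 = false ∷ true ∷ true ∷ false ∷ []
w1001 = true ∷ false ∷ false ∷ true ∷ []

Lint : ℕ → BWord → Set
Lint ℓ w =
  (count false w ≡ 2 * ℓ) × (count true w ≡ 2 * ℓ) ×
  ∃[ k ] ∃[ m ] (1 ≤ k × k ≤ ℓ × 1 ≤ m × m ≤ ℓ ×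
    (δ₂ ℓ k m w ≡ w0101 ⊎ δ₂ ℓ k m w ≡ w1010 ⊎
     δ₂ ℓ k m w ≡ w0110 ⊎ δ₂ ℓ k m w ≡ w1001))

h : ℕ → ℕ → List ℕ → BWord
h a b [] = []
h a b (x ∷ w) with x ≟ a
... | yes _ = false ∷ h a b w
... | no _ with x ≟ b
...   | yes _ = true ∷ h a b w
...   | no _ = h a b w

record Graph : Set₁ where
  field
    n     : ℕ
    Adj   : Fin n → Fin n → Set
    sym   : ∀ {u v} → Adj u v → Adj v u
    irrefl : ∀ {u} → ¬ Adj u u

open Graph public

-- G is isomorphic to G(L, w) for some word w: f is a bijection from the
-- vertices of G onto the set of letters of w which preserves adjacency.
InClass : (BWord → Set) → Graph → Set
InClass L G =
  ∃[ w ] Σ (Fin (n G) → ℕ) λ f →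
    Injective _≡_ _≡_ f ×
    (∀ i → f i ∈ w) ×
    (∀ x → x ∈ w → ∃[ i ] f i ≡ x) ×
    (∀ i j → i ≢ j → (Adj G i j ⇔ L (h (f i) (f j) w)))

record Interval : Set where
  constructor [_,_]⟨_⟩
  field
    lo : ℚ
    hi : ℚ
    lo≤hi : lo ≤ℚ hi

open Interval public

_∈I_ : ℚ → Interval → Set
x ∈I I = (lo I ≤ℚ x) × (x ≤ℚ hi I)

IntervalGraph : ℕ → Graph → Set
IntervalGraph ℓ G =
  Σ (Fin (n G) → Fin ℓ → Interval) λ f →
    ∀ u v → u ≢ v →
      (Adj G u v ⇔ (∃[ x ] ∃[ i ] ∃[ j ] (x ∈I f u i × x ∈I f v j)))

{-# OPTIONS --safe #-}
module Submission where

-- Pair the occurrences of each letter consecutively (1st with 2nd, 3rd with 4th, …).  The map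
-- δ_{k,m} keeps the k-th pair of 0s and the m-th pair of 1s, and the four patterns are exactly
-- the ways two such pairs interleave.  So a 2ℓ-uniform word lies in L_ℓ^int iff some pair of 0s
-- interleaves with some pair of 1s, which a left-to-right scan detects.
--
-- For a word w, the pairs of occurrences of a letter span ℓ intervals of positions, and h_{u,v}(w)
-- lies in L_ℓ^int iff an interval of u meets one of v; letters occurring a number of times other
-- than 2ℓ are isolated and get distinct negative points.  Conversely, given ℓ-interval
-- representations, sweep through the sorted left endpoints, opening a pair for every vertex that
-- becomes active and closing it before the next sample point where it is inactive.  Each opening
-- lies in a fresh interval, so a vertex opens at most ℓ pairs; padding with doubled letters gives
-- a 2ℓ-uniform word in which the pairs of u and v interleave iff u and v are active at a common
-- sample point, i.e. iff their unions of intervals meet.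

open import Data.Bool using (Bool; true; false; not; _∧_; _∨_; _xor_)
open import Data.Bool.Properties
  using ( not-involutive; not-distribˡ-xor; not-distribʳ-xor; xor-identityʳ
        ; ∨-assoc; ∨-zeroʳ; ∨-identityʳ; ∧-zeroʳ)
open import Data.Empty using (⊥-elim)
open import Data.Fin using (Fin; zero; suc; toℕ; fromℕ<)
open import Data.Fin.Properties using (toℕ-fromℕ<; toℕ-injective; toℕ<n; any?)
open import Data.Fin.Subset using (Subset; ⁅_⁆; _∪_; ∣_∣)
  renaming (_∈_ to _∈ˢ_; _∉_ to _∉ˢ_; ⊥ to ∅)
open import Data.Fin.Subset.Properties
  using (∣p∣≤n; ∣⊥∣≡0; ∉⊥; x∈⁅x⁆; x∈⁅y⁆⇒x≡y; q⊆p∪q; x∈p∪q⁻; x∈p∪q⁺; p⊂q⇒∣p∣<∣q∣)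
open import Data.Integer as ℤ using (ℤ)
import Data.Integer.Properties as ℤ
open import Data.List using (List; []; _∷_; _++_; length; map; replicate; concat; tabulate)
open import Data.List.Membership.Propositional using (_∈_)
open import Data.List.Membership.Propositional.Properties using (∈-concat⁺′; ∈-tabulate⁺)
open import Data.List.Relation.Binary.Permutation.Propositional using (↭-sym)
open import Data.List.Relation.Binary.Permutation.Propositional.Properties using (∈-resp-↭)
open import Data.List.Relation.Unary.All as All using (All; [])
import Data.List.Relation.Unary.All.Properties as All
open import Data.List.Relation.Unary.Any using (here; there)
open import Data.List.Relation.Unary.Linked as Linked using (Linked)
open import Data.Nat using (ℕ; zero; suc; _+_; _*_; _∸_; _≤_; _<_; _≤ᵇ_; z≤n; s≤s; z<s; s<s)
open import Data.Nat.Coprimality using (1-coprimeTo) renaming (sym to coprime-sym)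
open import Data.Nat.Properties
open import Data.Nat.Tactic.RingSolver using (solve)
open import Data.Product using (∃-syntax; _×_; _,_; proj₁; proj₂)
open import Data.Rational as ℚ using (ℚ; mkℚ; *≤*)
import Data.Rational.Properties as ℚ
open import Data.List.Sort ℚ.≤-decTotalOrder using (sort; sort-↭; sort-↗)
open import Data.Sum using (_⊎_; inj₁; inj₂; reduce)
open import Function using (_∘_)
open import Function.Bundles using (_⇔_; mk⇔; Equivalence)
open import Function.Construct.Composition using () renaming (equivalence to ⇔-trans)
open import Function.Construct.Symmetry using (⇔-sym)
open import Relation.Binary.Definitions using (tri<; tri≈; tri>)
open import Relation.Binary.PropositionalEquality
open import Relation.Nullary using (¬_; Dec; yes; no; does)
open import Relation.Nullary.Decidable using (dec-true; dec-false; _×-dec_)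

open import Defs hiding (sym)

bit : Bool → ℕ
bit false = 0
bit true = 1

odd : ℕ → Bool
odd zero = false
odd (suc n) = not (odd n)

odd≡false⇒even : ∀ n → odd n ≡ false → ∃[ k ] n ≡ 2 * k
odd≡true⇒odd : ∀ n → odd n ≡ true → ∃[ k ] n ≡ suc (2 * k)
odd≡false⇒even zero _ = 0 , refl
odd≡false⇒even (suc n) e with odd≡true⇒odd n (trans (sym (not-involutive _)) (cong not e))
... | k , refl = suc k , cong suc (sym (+-suc k (k + 0)))
odd≡true⇒odd zero ()
odd≡true⇒odd (suc n) e with odd≡false⇒even n (trans (sym (not-involutive _)) (cong not e))
... | k , refl = k , refl

data Even : ℕ → Set where
  zero : Even 0
  2+_  : ∀ {n} → Even n → Even (suc (suc n))

Even-+ : ∀ {m n} → Even m → Even n → Even (m + n)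
Even-+ zero e = e
Even-+ (2+ d) e = 2+ Even-+ d e

Even-2* : ∀ n → Even (2 * n)
Even-2* zero = zero
Even-2* (suc n) rewrite +-suc n (n + 0) = 2+ Even-2* n

Even-<⇒2+≤ : ∀ {m n} → Even m → Even n → m < n → 2 + m ≤ n
Even-<⇒2+≤ zero (2+ _) _ = s≤s (s≤s z≤n)
Even-<⇒2+≤ (2+ d) (2+ e) (s≤s (s≤s lt)) = s≤s (s≤s (Even-<⇒2+≤ d e lt))

1+2k+c≡2ℓ⇒k<ℓ×1≤c : ∀ k c ℓ → suc (2 * k) + c ≡ 2 * ℓ → k < ℓ × 1 ≤ c
1+2k+c≡2ℓ⇒k<ℓ×1≤c k zero ℓ e = ⊥-elim (even≢odd ℓ k (sym (trans (sym (+-identityʳ _)) e)))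
1+2k+c≡2ℓ⇒k<ℓ×1≤c k (suc c) ℓ e =
  *-cancelˡ-< 2 k ℓ (subst (suc (2 * k) ≤_) e (m≤m+n _ _)) , s≤s z≤n

≤ᵇ-true : ∀ {m n} → m ≤ n → (m ≤ᵇ n) ≡ true
≤ᵇ-true = dec-true (_ ≤? _)

≤ᵇ-false : ∀ {m n} → ¬ m ≤ n → (m ≤ᵇ n) ≡ false
≤ᵇ-false = dec-false (_ ≤? _)

count-++ : ∀ c x y → count c (x ++ y) ≡ count c x + count c y
count-++ c [] y = refl
count-++ false (false ∷ x) y = cong suc (count-++ false x y)
count-++ false (true ∷ x) y = count-++ false x y
count-++ true (false ∷ x) y = count-++ true x y
count-++ true (true ∷ x) y = cong suc (count-++ true x y)

length≡count+count : ∀ v → length v ≡ count false v + count true v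
length≡count+count [] = refl
length≡count+count (false ∷ v) = cong suc (length≡count+count v)
length≡count+count (true ∷ v) = trans (cong suc (length≡count+count v)) (sym (+-suc _ _))

zeroThenOne oneThenZero : Bool → Bool → BWord
zeroThenOne false false = []
zeroThenOne false true = true ∷ []
zeroThenOne true false = false ∷ []
zeroThenOne true true = false ∷ true ∷ []
oneThenZero true true = true ∷ false ∷ []
oneThenZero p q = zeroThenOne p q

word-with-counts≤1 : ∀ s p q → count false s ≡ bit p → count true s ≡ bit q →
  s ≡ zeroThenOne p q ⊎ s ≡ oneThenZero p q
word-with-counts≤1 [] false false _ _ = inj₁ refl
word-with-counts≤1 (false ∷ s) true false e0 e1 =
  inj₁ (cong (false ∷_) (reduce (word-with-counts≤1 s false false (suc-injective e0) e1)))
word-with-counts≤1 (false ∷ s) true true e0 e1 =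
  inj₁ (cong (false ∷_) (reduce (word-with-counts≤1 s false true (suc-injective e0) e1)))
word-with-counts≤1 (true ∷ s) false true e0 e1 =
  inj₁ (cong (true ∷_) (reduce (word-with-counts≤1 s false false e0 (suc-injective e1))))
word-with-counts≤1 (true ∷ s) true true e0 e1 =
  inj₂ (cong (true ∷_) (reduce (word-with-counts≤1 s true false e0 (suc-injective e1))))
word-with-counts≤1 [] false true _ ()
word-with-counts≤1 [] true _ () _
word-with-counts≤1 (false ∷ s) false _ () _
word-with-counts≤1 (true ∷ s) _ false _ ()

-- Interleaving pairs of 0s and 1s

xor-not : ∀ p q → not p xor q ≡ p xor not q
xor-not p q = trans (sym (not-distribˡ-xor p q)) (not-distribʳ-xor p q)

-- p and q say whether a pair of 0s, resp. of 1s, is open; the scan reports a letter that opens a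
-- pair while the other letter has one open.
crosses : Bool → Bool → BWord → Bool
crosses p q [] = false
crosses p q (false ∷ v) = (not p ∧ q) ∨ crosses (not p) q v
crosses p q (true ∷ v) = (not q ∧ p) ∨ crosses p (not q) v

crosses-++ : ∀ p q s t →
  crosses p q (s ++ t) ≡ crosses p q s ∨ crosses (p xor odd (count false s)) (q xor odd (count true s)) t
crosses-++ p q [] t = sym (cong₂ (λ p′ q′ → crosses p′ q′ t) (xor-identityʳ p) (xor-identityʳ q))
crosses-++ p q (false ∷ s) t = begin
  (not p ∧ q) ∨ crosses (not p) q (s ++ t)
    ≡⟨ cong ((not p ∧ q) ∨_) (crosses-++ (not p) q s t) ⟩
  (not p ∧ q) ∨ (crosses (not p) q s ∨ crosses (not p xor odd (count false s)) _ t)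
    ≡⟨ sym (∨-assoc (not p ∧ q) _ _) ⟩
  crosses p q (false ∷ s) ∨ crosses (not p xor odd (count false s)) _ t
    ≡⟨ cong (λ p′ → crosses p q (false ∷ s) ∨ crosses p′ _ t) (xor-not p _) ⟩
  crosses p q (false ∷ s) ∨ crosses (p xor not (odd (count false s))) _ t ∎
  where open ≡-Reasoning
crosses-++ p q (true ∷ s) t = begin
  (not q ∧ p) ∨ crosses p (not q) (s ++ t)
    ≡⟨ cong ((not q ∧ p) ∨_) (crosses-++ p (not q) s t) ⟩
  (not q ∧ p) ∨ (crosses p (not q) s ∨ crosses _ (not q xor odd (count true s)) t)
    ≡⟨ sym (∨-assoc (not q ∧ p) _ _) ⟩
  crosses p q (true ∷ s) ∨ crosses _ (not q xor odd (count true s)) t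
    ≡⟨ cong (λ q′ → crosses p q (true ∷ s) ∨ crosses _ q′ t) (xor-not q _) ⟩
  crosses p q (true ∷ s) ∨ crosses _ (q xor not (odd (count true s))) t ∎
  where open ≡-Reasoning

Crossing : Bool → Bool → BWord → Set
Crossing p q v = ∃[ x ] ∃[ y ]
  ((v ≡ x ++ false ∷ y × p xor odd (count false x) ≡ false × q xor odd (count true x) ≡ true) ⊎
   (v ≡ x ++ true ∷ y × q xor odd (count true x) ≡ false × p xor odd (count false x) ≡ true))

Crossing-false∷ : ∀ p q v → Crossing (not p) q v → Crossing p q (false ∷ v)
Crossing-false∷ p q v (x , y , inj₁ (refl , e0 , e1)) =
  false ∷ x , y , inj₁ (refl , trans (sym (xor-not p _)) e0 , e1)
Crossing-false∷ p q v (x , y , inj₂ (refl , e1 , e0)) =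
  false ∷ x , y , inj₂ (refl , e1 , trans (sym (xor-not p _)) e0)

Crossing-true∷ : ∀ p q v → Crossing p (not q) v → Crossing p q (true ∷ v)
Crossing-true∷ p q v (x , y , inj₁ (refl , e0 , e1)) =
  true ∷ x , y , inj₁ (refl , e0 , trans (sym (xor-not q _)) e1)
Crossing-true∷ p q v (x , y , inj₂ (refl , e1 , e0)) =
  true ∷ x , y , inj₂ (refl , trans (sym (xor-not q _)) e1 , e0)

crosses⇒Crossing : ∀ p q v → crosses p q v ≡ true → Crossing p q v
crosses⇒Crossing p q [] ()
crosses⇒Crossing false true (false ∷ v) _ = [] , v , inj₁ (refl , refl , refl)
crosses⇒Crossing true false (true ∷ v) _ = [] , v , inj₂ (refl , refl , refl)
crosses⇒Crossing true q (false ∷ v) e = Crossing-false∷ true q v (crosses⇒Crossing false q v e)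
crosses⇒Crossing false false (false ∷ v) e = Crossing-false∷ false false v (crosses⇒Crossing true false v e)
crosses⇒Crossing p true (true ∷ v) e = Crossing-true∷ p true v (crosses⇒Crossing p false v e)
crosses⇒Crossing false false (true ∷ v) e = Crossing-true∷ false false v (crosses⇒Crossing false true v e)

data Doubled {A : Set} : List A → Set where
  []  : Doubled []
  dup : ∀ x {v} → Doubled v → Doubled (x ∷ x ∷ v)

Doubled-++ : ∀ {A : Set} {x y : List A} → Doubled x → Doubled y → Doubled (x ++ y)
Doubled-++ [] d = d
Doubled-++ (dup c d) e = dup c (Doubled-++ d e)

Doubled⇒¬crosses : ∀ {v} → Doubled v → crosses false false v ≡ false
Doubled⇒¬crosses [] = refl
Doubled⇒¬crosses (dup false d) = Doubled⇒¬crosses d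
Doubled⇒¬crosses (dup true d) = Doubled⇒¬crosses d

¬crosses⇒Doubled : ∀ v → Even (length v) → crosses false false v ≡ false → Doubled v
¬crosses⇒Doubled [] _ _ = []
¬crosses⇒Doubled (false ∷ false ∷ v) (2+ e) c = dup false (¬crosses⇒Doubled v e c)
¬crosses⇒Doubled (true ∷ true ∷ v) (2+ e) c = dup true (¬crosses⇒Doubled v e c)
¬crosses⇒Doubled (false ∷ true ∷ v) _ ()
¬crosses⇒Doubled (true ∷ false ∷ v) _ ()

Pattern : BWord → Set
Pattern s = s ≡ w0101 ⊎ s ≡ w1010 ⊎ s ≡ w0110 ⊎ s ≡ w1001

Doubled⇒¬Pattern : ∀ {s} → Doubled s → ¬ Pattern s
Doubled⇒¬Pattern (dup c _) (inj₁ ())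
Doubled⇒¬Pattern (dup c _) (inj₂ (inj₁ ()))
Doubled⇒¬Pattern (dup c _) (inj₂ (inj₂ (inj₁ ())))
Doubled⇒¬Pattern (dup c _) (inj₂ (inj₂ (inj₂ ())))

-- Selecting one pair of each letter

countInRange : ℕ → ℕ → ℕ → ℕ → ℕ
countInRange lo hi c zero = 0
countInRange lo hi c (suc k) = bit ((lo ≤ᵇ suc c) ∧ (suc c ≤ᵇ hi)) + countInRange lo hi (suc c) k

countInRange-+ : ∀ lo hi c k l →
  countInRange lo hi c (k + l) ≡ countInRange lo hi c k + countInRange lo hi (c + k) l
countInRange-+ lo hi c zero l rewrite +-identityʳ c = refl
countInRange-+ lo hi c (suc k) l rewrite +-suc c k =
  trans (cong (bit ((lo ≤ᵇ suc c) ∧ (suc c ≤ᵇ hi)) +_) (countInRange-+ lo hi (suc c) k l))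
        (sym (+-assoc (bit ((lo ≤ᵇ suc c) ∧ (suc c ≤ᵇ hi))) _ _))

countInRange-above : ∀ lo hi c k → hi ≤ c → countInRange lo hi c k ≡ 0
countInRange-above lo hi c zero _ = refl
countInRange-above lo hi c (suc k) hi≤c
  rewrite ≤ᵇ-false {suc c} {hi} (λ c<hi → 1+n≰n (≤-trans c<hi hi≤c)) | ∧-zeroʳ (lo ≤ᵇ suc c)
  = countInRange-above lo hi (suc c) k (m≤n⇒m≤1+n hi≤c)

countInRange-below : ∀ lo hi c k → c + k < lo → countInRange lo hi c k ≡ 0
countInRange-below lo hi c zero _ = refl
countInRange-below lo hi c (suc k) c+k<lo
  rewrite +-suc c k
        | ≤ᵇ-false {lo} {suc c} (λ lo≤c → <⇒≱ c+k<lo (≤-trans lo≤c (s≤s (m≤m+n c k))))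
  = countInRange-below lo hi (suc c) k c+k<lo

count-select-false : ∀ lo0 hi0 lo1 hi1 c0 c1 w →
  count false (select lo0 hi0 lo1 hi1 c0 c1 w) ≡ countInRange lo0 hi0 c0 (count false w)
count-select-false lo0 hi0 lo1 hi1 c0 c1 [] = refl
count-select-false lo0 hi0 lo1 hi1 c0 c1 (false ∷ w) with (lo0 ≤ᵇ suc c0) ∧ (suc c0 ≤ᵇ hi0)
... | true = cong suc (count-select-false lo0 hi0 lo1 hi1 (suc c0) c1 w)
... | false = count-select-false lo0 hi0 lo1 hi1 (suc c0) c1 w
count-select-false lo0 hi0 lo1 hi1 c0 c1 (true ∷ w) with (lo1 ≤ᵇ suc c1) ∧ (suc c1 ≤ᵇ hi1)
... | true = count-select-false lo0 hi0 lo1 hi1 c0 (suc c1) w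
... | false = count-select-false lo0 hi0 lo1 hi1 c0 (suc c1) w

count-select-true : ∀ lo0 hi0 lo1 hi1 c0 c1 w →
  count true (select lo0 hi0 lo1 hi1 c0 c1 w) ≡ countInRange lo1 hi1 c1 (count true w)
count-select-true lo0 hi0 lo1 hi1 c0 c1 [] = refl
count-select-true lo0 hi0 lo1 hi1 c0 c1 (false ∷ w) with (lo0 ≤ᵇ suc c0) ∧ (suc c0 ≤ᵇ hi0)
... | true = count-select-true lo0 hi0 lo1 hi1 (suc c0) c1 w
... | false = count-select-true lo0 hi0 lo1 hi1 (suc c0) c1 w
count-select-true lo0 hi0 lo1 hi1 c0 c1 (true ∷ w) with (lo1 ≤ᵇ suc c1) ∧ (suc c1 ≤ᵇ hi1)
... | true = cong suc (count-select-true lo0 hi0 lo1 hi1 c0 (suc c1) w)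
... | false = count-select-true lo0 hi0 lo1 hi1 c0 (suc c1) w

select-++ : ∀ lo0 hi0 lo1 hi1 c0 c1 x y →
  select lo0 hi0 lo1 hi1 c0 c1 (x ++ y) ≡
  select lo0 hi0 lo1 hi1 c0 c1 x ++ select lo0 hi0 lo1 hi1 (c0 + count false x) (c1 + count true x) y
select-++ lo0 hi0 lo1 hi1 c0 c1 [] y rewrite +-identityʳ c0 | +-identityʳ c1 = refl
select-++ lo0 hi0 lo1 hi1 c0 c1 (false ∷ x) y rewrite +-suc c0 (count false x)
  with (lo0 ≤ᵇ suc c0) ∧ (suc c0 ≤ᵇ hi0)
... | true = cong (false ∷_) (select-++ lo0 hi0 lo1 hi1 (suc c0) c1 x y)
... | false = select-++ lo0 hi0 lo1 hi1 (suc c0) c1 x y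
select-++ lo0 hi0 lo1 hi1 c0 c1 (true ∷ x) y rewrite +-suc c1 (count true x)
  with (lo1 ≤ᵇ suc c1) ∧ (suc c1 ≤ᵇ hi1)
... | true = cong (true ∷_) (select-++ lo0 hi0 lo1 hi1 c0 (suc c1) x y)
... | false = select-++ lo0 hi0 lo1 hi1 c0 (suc c1) x y

window : ℕ → ℕ → ℕ → ℕ → BWord → BWord
window k m = select (suc (2 * k)) (2 + 2 * k) (suc (2 * m)) (2 + 2 * m)

2*[1+k]∸1≡1+2k : ∀ k → 2 * suc k ∸ 1 ≡ suc (2 * k)
2*[1+k]∸1≡1+2k k = +-suc k (k + 0)

2*[k+1]≡2+2k : ∀ k → 2 * (k + 1) ≡ 2 + 2 * k
2*[k+1]≡2+2k k = trans (*-distribˡ-+ 2 k 1) (+-comm (2 * k) 2)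

δ₂≡window : ∀ ℓ k m v → δ₂ ℓ (suc k) (suc m) v ≡ window k m 0 0 v
δ₂≡window ℓ k m v
  rewrite 2*[1+k]∸1≡1+2k k | 2*[k+1]≡2+2k k | 2*[1+k]∸1≡1+2k m | 2*[k+1]≡2+2k m = refl

countInRange-window-start : ∀ k → countInRange (suc (2 * k)) (2 + 2 * k) 0 (suc (2 * k)) ≡ 1
countInRange-window-start k =
  trans (cong (countInRange (suc (2 * k)) (2 + 2 * k) 0) (+-comm 1 (2 * k)))
  (trans (countInRange-+ (suc (2 * k)) (2 + 2 * k) 0 (2 * k) 1)
         (cong₂ _+_ (countInRange-below (suc (2 * k)) (2 + 2 * k) 0 (2 * k) ≤-refl) last-hit))
  where
  last-hit : countInRange (suc (2 * k)) (2 + 2 * k) (2 * k) 1 ≡ 1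
  last-hit rewrite ≤ᵇ-true (≤-refl {suc (2 * k)}) | ≤ᵇ-true (n≤1+n (suc (2 * k))) = refl

countInRange-window-rest : ∀ k n → 1 ≤ n → countInRange (suc (2 * k)) (2 + 2 * k) (suc (2 * k)) n ≡ 1
countInRange-window-rest k (suc n) _
  rewrite ≤ᵇ-true (n≤1+n (suc (2 * k))) | ≤ᵇ-true (≤-refl {2 + 2 * k})
  = cong suc (countInRange-above (suc (2 * k)) (2 + 2 * k) (2 + 2 * k) n ≤-refl)

window-prefix-false : ∀ k m x → count false x ≡ 2 * k → count true x ≡ suc (2 * m) →
  window k m 0 0 x ≡ true ∷ []
window-prefix-false k m x x0 x1 = reduce (word-with-counts≤1 _ false true
  (trans (count-select-false _ _ _ _ 0 0 x)
         (trans (cong (countInRange _ _ 0) x0) (countInRange-below _ _ 0 (2 * k) ≤-refl)))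
  (trans (count-select-true _ _ _ _ 0 0 x)
         (trans (cong (countInRange _ _ 0) x1) (countInRange-window-start m))))

window-prefix-true : ∀ k m x → count false x ≡ suc (2 * k) → count true x ≡ 2 * m →
  window k m 0 0 x ≡ false ∷ []
window-prefix-true k m x x0 x1 = reduce (word-with-counts≤1 _ true false
  (trans (count-select-false _ _ _ _ 0 0 x)
         (trans (cong (countInRange _ _ 0) x0) (countInRange-window-start k)))
  (trans (count-select-true _ _ _ _ 0 0 x)
         (trans (cong (countInRange _ _ 0) x1) (countInRange-below _ _ 0 (2 * m) ≤-refl))))

window-suffix : ∀ k m y → 1 ≤ count false y → 1 ≤ count true y →
  window k m (suc (2 * k)) (suc (2 * m)) y ≡ false ∷ true ∷ [] ⊎
  window k m (suc (2 * k)) (suc (2 * m)) y ≡ true ∷ false ∷ []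
window-suffix k m y y0 y1 = word-with-counts≤1 _ true true
  (trans (count-select-false _ _ _ _ _ _ y) (countInRange-window-rest k _ y0))
  (trans (count-select-true _ _ _ _ _ _ y) (countInRange-window-rest m _ y1))

Pattern-window-false : ∀ k m x y → count false x ≡ 2 * k → count true x ≡ suc (2 * m) →
  1 ≤ count false y → 1 ≤ count true y → Pattern (window k m 0 0 (x ++ false ∷ y))
Pattern-window-false k m x y x0 x1 y0 y1
  rewrite select-++ (suc (2 * k)) (2 + 2 * k) (suc (2 * m)) (2 + 2 * m) 0 0 x (false ∷ y)
        | window-prefix-false k m x x0 x1 | x0 | x1
        | ≤ᵇ-true (≤-refl {suc (2 * k)}) | ≤ᵇ-true (n≤1+n (suc (2 * k)))
  with window-suffix k m y y0 y1
... | inj₁ e = inj₂ (inj₂ (inj₂ (cong (λ s → true ∷ false ∷ s) e)))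
... | inj₂ e = inj₂ (inj₁ (cong (λ s → true ∷ false ∷ s) e))

Pattern-window-true : ∀ k m x y → count false x ≡ suc (2 * k) → count true x ≡ 2 * m →
  1 ≤ count false y → 1 ≤ count true y → Pattern (window k m 0 0 (x ++ true ∷ y))
Pattern-window-true k m x y x0 x1 y0 y1
  rewrite select-++ (suc (2 * k)) (2 + 2 * k) (suc (2 * m)) (2 + 2 * m) 0 0 x (true ∷ y)
        | window-prefix-true k m x x0 x1 | x0 | x1
        | ≤ᵇ-true (≤-refl {suc (2 * m)}) | ≤ᵇ-true (n≤1+n (suc (2 * m)))
  with window-suffix k m y y0 y1
... | inj₁ e = inj₁ (cong (λ s → false ∷ true ∷ s) e)
... | inj₂ e = inj₂ (inj₂ (inj₁ (cong (λ s → false ∷ true ∷ s) e)))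

-- A window [d + 1, d + 2] with d even keeps both letters of a pair or neither.
pair-aligned : ∀ {d c} → Even d → Even c →
  (suc d ≤ᵇ suc c) ∧ (suc c ≤ᵇ 2 + d) ≡ (suc d ≤ᵇ 2 + c) ∧ (2 + c ≤ᵇ 2 + d)
pair-aligned {d} {c} ed ec with <-cmp d c
... | tri≈ _ refl _ rewrite ≤ᵇ-true (≤-refl {suc d}) | ≤ᵇ-true (n≤1+n (suc d)) = refl
... | tri< d<c _ _
  rewrite ≤ᵇ-false {suc c} {2 + d} (λ le → <⇒≱ (Even-<⇒2+≤ ed ec d<c) (≤-pred le))
        | ≤ᵇ-false {2 + c} {2 + d}
                   (λ le → <⇒≱ (Even-<⇒2+≤ ed ec d<c) (≤-trans (n≤1+n c) (≤-pred le)))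
        | ∧-zeroʳ (suc d ≤ᵇ suc c) | ∧-zeroʳ (suc d ≤ᵇ 2 + c) = refl
... | tri> _ _ c<d
  rewrite ≤ᵇ-false {suc d} {suc c}
                   (λ le → <⇒≱ (Even-<⇒2+≤ ec ed c<d) (≤-trans (≤-pred le) (n≤1+n c)))
        | ≤ᵇ-false {suc d} {2 + c} (λ le → <⇒≱ (Even-<⇒2+≤ ec ed c<d) (≤-pred le)) = refl

select-Doubled : ∀ {d0 d1 c0 c1 v} → Even d0 → Even d1 → Even c0 → Even c1 → Doubled v →
  Doubled (select (suc d0) (2 + d0) (suc d1) (2 + d1) c0 c1 v)
select-Doubled _ _ _ _ [] = []
select-Doubled {d0} {c0 = c0} e0 e1 f0 f1 (dup false d)
  rewrite sym (pair-aligned e0 f0) with (suc d0 ≤ᵇ suc c0) ∧ (suc c0 ≤ᵇ 2 + d0)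
... | true = dup false (select-Doubled e0 e1 (2+ f0) f1 d)
... | false = select-Doubled e0 e1 (2+ f0) f1 d
select-Doubled {d1 = d1} {c1 = c1} e0 e1 f0 f1 (dup true d)
  rewrite sym (pair-aligned e1 f1) with (suc d1 ≤ᵇ suc c1) ∧ (suc c1 ≤ᵇ 2 + d1)
... | true = dup true (select-Doubled e0 e1 f0 (2+ f1) d)
... | false = select-Doubled e0 e1 f0 (2+ f1) d

count-++-∷ : ∀ c x d y {n N} → count c x ≡ n → count c (x ++ d ∷ y) ≡ N → n + count c (d ∷ y) ≡ N
count-++-∷ c x d y refl e = trans (sym (count-++ c x (d ∷ y))) e

crosses⇒Lint : ∀ ℓ v → count false v ≡ 2 * ℓ → count true v ≡ 2 * ℓ →
  crosses false false v ≡ true → Lint ℓ v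
crosses⇒Lint ℓ v c0 c1 cr with crosses⇒Crossing false false v cr
... | x , y , inj₁ (refl , x0 , x1)
  with odd≡false⇒even _ x0 | odd≡true⇒odd _ x1
...  | k , ek | m , em
  with 1+2k+c≡2ℓ⇒k<ℓ×1≤c k _ ℓ (trans (sym (+-suc (2 * k) _)) (count-++-∷ false x false y ek c0))
     | 1+2k+c≡2ℓ⇒k<ℓ×1≤c m _ ℓ (count-++-∷ true x false y em c1)
...  | k<ℓ , y0 | m<ℓ , y1 =
  c0 , c1 , suc k , suc m , s≤s z≤n , k<ℓ , s≤s z≤n , m<ℓ ,
  subst Pattern (sym (δ₂≡window ℓ k m (x ++ false ∷ y))) (Pattern-window-false k m x y ek em y0 y1)
crosses⇒Lint ℓ v c0 c1 cr | x , y , inj₂ (refl , x1 , x0)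
  with odd≡true⇒odd _ x0 | odd≡false⇒even _ x1
...  | k , ek | m , em
  with 1+2k+c≡2ℓ⇒k<ℓ×1≤c k _ ℓ (count-++-∷ false x true y ek c0)
     | 1+2k+c≡2ℓ⇒k<ℓ×1≤c m _ ℓ (trans (sym (+-suc (2 * m) _)) (count-++-∷ true x true y em c1))
...  | k<ℓ , y0 | m<ℓ , y1 =
  c0 , c1 , suc k , suc m , s≤s z≤n , k<ℓ , s≤s z≤n , m<ℓ ,
  subst Pattern (sym (δ₂≡window ℓ k m (x ++ true ∷ y))) (Pattern-window-true k m x y ek em y0 y1)

-- Without a crossing every pair consists of two adjacent letters, and so it does in the window.
Lint⇒crosses : ∀ ℓ v → Lint ℓ v → crosses false false v ≡ true
Lint⇒crosses ℓ v (c0 , c1 , suc k , suc m , _ , _ , _ , _ , δ-pattern) with crosses false false v in eq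
... | true = refl
... | false = ⊥-elim (Doubled⇒¬Pattern doubled-window (subst Pattern (δ₂≡window ℓ k m v) δ-pattern))
  where
  even-length : Even (length v)
  even-length = subst Even (sym (trans (length≡count+count v) (cong₂ _+_ c0 c1)))
                      (Even-+ (Even-2* ℓ) (Even-2* ℓ))
  doubled-window : Doubled (window k m 0 0 v)
  doubled-window = select-Doubled (Even-2* k) (Even-2* m) zero zero (¬crosses⇒Doubled v even-length eq)

Lint⇔crosses : ∀ ℓ v →
  Lint ℓ v ⇔ (count false v ≡ 2 * ℓ × count true v ≡ 2 * ℓ × crosses false false v ≡ true)
Lint⇔crosses ℓ v = mk⇔ (λ L@(c0 , c1 , _) → c0 , c1 , Lint⇒crosses ℓ v L)
                       (λ (c0 , c1 , cr) → crosses⇒Lint ℓ v c0 c1 cr)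

infix 7 _is_
_is_ : ℕ → ℕ → Bool
x is a with x ≟ a
... | yes _ = true
... | no _ = false

occurrences : ℕ → List ℕ → ℕ
occurrences a [] = 0
occurrences a (x ∷ w) with x ≟ a
... | yes _ = suc (occurrences a w)
... | no _ = occurrences a w

occurrences-++ : ∀ a x y → occurrences a (x ++ y) ≡ occurrences a x + occurrences a y
occurrences-++ a [] y = refl
occurrences-++ a (x ∷ xs) y with x ≟ a
... | yes _ = cong suc (occurrences-++ a xs y)
... | no _ = occurrences-++ a xs y

h-++ : ∀ a b x y → h a b (x ++ y) ≡ h a b x ++ h a b y
h-++ a b [] y = refl
h-++ a b (x ∷ xs) y with x ≟ a
... | yes _ = cong (false ∷_) (h-++ a b xs y)
... | no _ with x ≟ b
...   | yes _ = cong (true ∷_) (h-++ a b xs y)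
...   | no _ = h-++ a b xs y

count-false-h : ∀ a b w → count false (h a b w) ≡ occurrences a w
count-false-h a b [] = refl
count-false-h a b (x ∷ w) with x ≟ a
... | yes _ = cong suc (count-false-h a b w)
... | no _ with x ≟ b
...   | yes _ = count-false-h a b w
...   | no _ = count-false-h a b w

count-true-h : ∀ a b w → a ≢ b → count true (h a b w) ≡ occurrences b w
count-true-h a b [] _ = refl
count-true-h a b (x ∷ w) a≢b with x ≟ a
... | yes refl with x ≟ b
...   | yes refl = ⊥-elim (a≢b refl)
...   | no _ = count-true-h a b w a≢b
count-true-h a b (x ∷ w) a≢b | no _ with x ≟ b
...   | yes _ = cong suc (count-true-h a b w a≢b)
...   | no _ = count-true-h a b w a≢b

Doubled-h : ∀ a b {w} → Doubled w → Doubled (h a b w)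
Doubled-h a b [] = []
Doubled-h a b (dup x {v} d)
  rewrite h-++ a b (x ∷ []) (x ∷ v) | h-++ a b (x ∷ []) v with x ≟ a
... | yes _ = dup false (Doubled-h a b d)
... | no _ with x ≟ b
...   | yes _ = dup true (Doubled-h a b d)
...   | no _ = Doubled-h a b d

∨≡true⁻ : ∀ {x y} → x ∨ y ≡ true → x ≡ true ⊎ y ≡ true
∨≡true⁻ {true} _ = inj₁ refl
∨≡true⁻ {false} e = inj₂ e

∨≡trueʳ : ∀ x {y} → y ≡ true → x ∨ y ≡ true
∨≡trueʳ x refl = ∨-zeroʳ x

∧≡true⁻ : ∀ {x y} → x ∧ y ≡ true → x ≡ true × y ≡ true
∧≡true⁻ {true} {true} _ = refl , refl

-- Position t of w lies between two paired occurrences of a (inclusively); p says whether a pair of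
-- a is already open at the start of w.
activeAt : ℕ → Bool → List ℕ → ℕ → Bool
activeAt a p [] t = false
activeAt a p (x ∷ w) zero = p ∨ x is a
activeAt a p (x ∷ w) (suc t) = activeAt a (p xor x is a) w t

coactive : ℕ → ℕ → Bool → Bool → List ℕ → Bool
coactive a b p q [] = false
coactive a b p q (x ∷ w) =
  ((p ∨ x is a) ∧ (q ∨ x is b)) ∨ coactive a b (p xor x is a) (q xor x is b) w

coactive⇒ : ∀ a b p q w → coactive a b p q w ≡ true →
  ∃[ t ] (activeAt a p w t ≡ true × activeAt b q w t ≡ true)
coactive⇒ a b p q [] ()
coactive⇒ a b p q (x ∷ w) e with ∨≡true⁻ {(p ∨ x is a) ∧ (q ∨ x is b)} e
... | inj₁ now = 0 , ∧≡true⁻ now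
... | inj₂ later with coactive⇒ a b _ _ w later
...   | t , both = suc t , both

coactive⇐ : ∀ a b p q w t → activeAt a p w t ≡ true → activeAt b q w t ≡ true →
  coactive a b p q w ≡ true
coactive⇐ a b p q [] t ()
coactive⇐ a b p q (x ∷ w) zero ea eb rewrite ea | eb = refl
coactive⇐ a b p q (x ∷ w) (suc t) ea eb =
  ∨≡trueʳ ((p ∨ x is a) ∧ (q ∨ x is b)) (coactive⇐ a b _ _ w t ea eb)

crosses-h : ∀ a b → a ≢ b → ∀ p q w → p ∧ q ≡ false → crosses p q (h a b w) ≡ coactive a b p q w
crosses-h a b a≢b p q [] _ = refl
crosses-h a b a≢b p q (x ∷ w) closed with x ≟ a
... | yes refl with x ≟ b
...   | yes refl = ⊥-elim (a≢b refl)
...   | no _ = step p q closed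
  where
  step : ∀ p q → p ∧ q ≡ false →
    crosses p q (false ∷ h a b w) ≡ ((p ∨ true) ∧ (q ∨ false)) ∨ coactive a b (p xor true) (q xor false) w
  step false false _ = crosses-h a b a≢b true false w refl
  step false true _ = refl
  step true false _ = crosses-h a b a≢b false false w refl
crosses-h a b a≢b p q (x ∷ w) closed | no _ with x ≟ b
...   | yes _ = step p q closed
  where
  step : ∀ p q → p ∧ q ≡ false →
    crosses p q (true ∷ h a b w) ≡ ((p ∨ false) ∧ (q ∨ true)) ∨ coactive a b (p xor false) (q xor true) w
  step false false _ = crosses-h a b a≢b false true w refl
  step true false _ = refl
  step false true _ = crosses-h a b a≢b false false w refl
...   | no _ = step p q closed
  where
  step : ∀ p q → p ∧ q ≡ false →
    crosses p q (h a b w) ≡ ((p ∨ false) ∧ (q ∨ false)) ∨ coactive a b (p xor false) (q xor false) w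
  step false false _ = crosses-h a b a≢b false false w refl
  step true false _ = crosses-h a b a≢b true false w refl
  step false true _ = crosses-h a b a≢b false true w refl

-- the index of the (j + 1)-st occurrence of a in w (a junk value if there is none)
position : ℕ → ℕ → List ℕ → ℕ
position a j [] = 0
position a j (x ∷ w) with x ≟ a
position a zero (x ∷ w) | yes _ = 0
position a (suc j) (x ∷ w) | yes _ = suc (position a j w)
position a j (x ∷ w) | no _ = suc (position a j w)

position-mono : ∀ a j w → position a j w ≤ position a (suc j) w
position-mono a j [] = z≤n
position-mono a j (x ∷ w) with x ≟ a
position-mono a zero (x ∷ w) | yes _ = z≤n
position-mono a (suc j) (x ∷ w) | yes _ = s≤s (position-mono a j w)
position-mono a j (x ∷ w) | no _ = s≤s (position-mono a j w)

2*suc : ∀ k → 2 * suc k ≡ 2 + 2 * k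
2*suc k = cong suc (+-suc k (k + 0))

InPairs : ℕ → List ℕ → ℕ → ℕ → Set
InPairs a w K t = ∃[ k ] (k < K × position a (2 * k) w ≤ t × t ≤ position a (suc (2 * k)) w)

-- InPairs for a word that starts inside an open pair of a
InPairs′ : ℕ → List ℕ → ℕ → ℕ → Set
InPairs′ a w K t =
  t ≤ position a 0 w ⊎ ∃[ k ] (k < K × position a (suc (2 * k)) w ≤ t × t ≤ position a (2 + 2 * k) w)

InPairs⇒activeAt : ∀ a w K t → occurrences a w ≡ 2 * K → InPairs a w K t → activeAt a false w t ≡ true
InPairs′⇒activeAt : ∀ a w K t → occurrences a w ≡ suc (2 * K) →
  InPairs′ a w K t → activeAt a true w t ≡ true
InPairs⇒activeAt a [] zero t _ (_ , () , _)
InPairs⇒activeAt a (x ∷ w) K zero occ (k , k<K , l1 , l2) with x ≟ a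
... | yes _ = refl
InPairs⇒activeAt a (x ∷ w) K zero occ (k , k<K , () , l2) | no _
InPairs⇒activeAt a (x ∷ w) K (suc t) occ (k , k<K , l1 , l2) with x ≟ a
InPairs⇒activeAt a (x ∷ w) (suc K) (suc t) occ (zero , _ , _ , l2) | yes _ =
  InPairs′⇒activeAt a w K t (suc-injective (trans occ (2*suc K))) (inj₁ (≤-pred l2))
InPairs⇒activeAt a (x ∷ w) (suc K) (suc t) occ (suc k , s≤s k<K , l1 , l2) | yes _ =
  InPairs′⇒activeAt a w K t (suc-injective (trans occ (2*suc K)))
    (inj₂ (k , k<K , subst (_≤ t) (cong (λ j → position a j w) (+-suc k (k + 0))) (≤-pred l1) ,
                     subst (t ≤_) (cong (λ j → position a j w) (2*suc k)) (≤-pred l2)))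
... | no _ = InPairs⇒activeAt a w K t occ (k , k<K , ≤-pred l1 , ≤-pred l2)
InPairs′⇒activeAt a [] K t () _
InPairs′⇒activeAt a (x ∷ w) K zero occ _ = refl
InPairs′⇒activeAt a (x ∷ w) K (suc t) occ P with x ≟ a
InPairs′⇒activeAt a (x ∷ w) K (suc t) occ (inj₂ (k , k<K , l1 , l2)) | yes _ =
  InPairs⇒activeAt a w K t (suc-injective occ) (k , k<K , ≤-pred l1 , ≤-pred l2)
InPairs′⇒activeAt a (x ∷ w) K (suc t) occ (inj₁ l) | no _ =
  InPairs′⇒activeAt a w K t occ (inj₁ (≤-pred l))
InPairs′⇒activeAt a (x ∷ w) K (suc t) occ (inj₂ (k , k<K , l1 , l2)) | no _ =
  InPairs′⇒activeAt a w K t occ (inj₂ (k , k<K , ≤-pred l1 , ≤-pred l2))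

activeAt⇒InPairs : ∀ a w K t → occurrences a w ≡ 2 * K → activeAt a false w t ≡ true → InPairs a w K t
activeAt⇒InPairs′ : ∀ a w K t → occurrences a w ≡ suc (2 * K) →
  activeAt a true w t ≡ true → InPairs′ a w K t
activeAt⇒InPairs a [] K t _ ()
activeAt⇒InPairs a (x ∷ w) K zero occ act with x ≟ a
activeAt⇒InPairs a (x ∷ w) zero zero () act | yes _
activeAt⇒InPairs a (x ∷ w) (suc K) zero occ act | yes _ = 0 , s≤s z≤n , z≤n , z≤n
activeAt⇒InPairs a (x ∷ w) K zero occ () | no _
activeAt⇒InPairs a (x ∷ w) K (suc t) occ act with x ≟ a
activeAt⇒InPairs a (x ∷ w) zero (suc t) () act | yes _
activeAt⇒InPairs a (x ∷ w) (suc K) (suc t) occ act | yes _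
  with activeAt⇒InPairs′ a w K t (suc-injective (trans occ (2*suc K))) act
... | inj₁ l = 0 , s≤s z≤n , z≤n , s≤s l
... | inj₂ (k , k<K , l1 , l2) =
  suc k , s≤s k<K , s≤s (subst (_≤ t) (cong (λ j → position a j w) (sym (+-suc k (k + 0)))) l1) ,
                    s≤s (subst (t ≤_) (cong (λ j → position a j w) (sym (2*suc k))) l2)
activeAt⇒InPairs a (x ∷ w) K (suc t) occ act | no _ with activeAt⇒InPairs a w K t occ act
... | k , k<K , l1 , l2 = k , k<K , s≤s l1 , s≤s l2
activeAt⇒InPairs′ a [] K t () _
activeAt⇒InPairs′ a (x ∷ w) K zero occ act = inj₁ z≤n
activeAt⇒InPairs′ a (x ∷ w) K (suc t) occ act with x ≟ a
... | yes _ with activeAt⇒InPairs a w K t (suc-injective occ) act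
...   | k , k<K , l1 , l2 = inj₂ (k , k<K , s≤s l1 , s≤s l2)
activeAt⇒InPairs′ a (x ∷ w) K (suc t) occ act | no _ with activeAt⇒InPairs′ a w K t occ act
...   | inj₁ l = inj₁ (s≤s l)
...   | inj₂ (k , k<K , l1 , l2) = inj₂ (k , k<K , s≤s l1 , s≤s l2)

Lint-h⇒occurrences : ∀ ℓ a b w → a ≢ b → Lint ℓ (h a b w) →
  occurrences a w ≡ 2 * ℓ × occurrences b w ≡ 2 * ℓ
Lint-h⇒occurrences ℓ a b w a≢b (c0 , c1 , _) =
  trans (sym (count-false-h a b w)) c0 , trans (sym (count-true-h a b w a≢b)) c1

Lint-h⇔crosses : ∀ ℓ a b w → a ≢ b → occurrences a w ≡ 2 * ℓ → occurrences b w ≡ 2 * ℓ →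
  Lint ℓ (h a b w) ⇔ crosses false false (h a b w) ≡ true
Lint-h⇔crosses ℓ a b w a≢b occ-a occ-b = mk⇔
  (λ L → proj₂ (proj₂ (Equivalence.to (Lint⇔crosses ℓ (h a b w)) L)))
  (λ cr → Equivalence.from (Lint⇔crosses ℓ (h a b w))
            (trans (count-false-h a b w) occ-a , trans (count-true-h a b w a≢b) occ-b , cr))

crosses-h⇔InPairs : ∀ a b w K → a ≢ b → occurrences a w ≡ 2 * K → occurrences b w ≡ 2 * K →
  crosses false false (h a b w) ≡ true ⇔ (∃[ t ] (InPairs a w K t × InPairs b w K t))
crosses-h⇔InPairs a b w K a≢b occ-a occ-b = mk⇔
  (λ cr → let t , act-a , act-b = coactive⇒ a b false false w (trans (sym crosses≡coactive) cr)
          in t , activeAt⇒InPairs a w K t occ-a act-a , activeAt⇒InPairs b w K t occ-b act-b)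
  (λ (t , in-a , in-b) → trans crosses≡coactive
      (coactive⇐ a b false false w t (InPairs⇒activeAt a w K t occ-a in-a)
                                      (InPairs⇒activeAt b w K t occ-b in-b)))
  where
  crosses≡coactive : crosses false false (h a b w) ≡ coactive a b false false w
  crosses≡coactive = crosses-h a b a≢b false false w refl

-- From words to interval representations

fromℤ : ℤ → ℚ
fromℤ z = mkℚ z 0 (coprime-sym (1-coprimeTo _))

fromℤ-mono : ∀ {p q} → p ℤ.≤ q → fromℤ p ℚ.≤ fromℤ q
fromℤ-mono {p} {q} p≤q = *≤* (subst₂ ℤ._≤_ (sym (ℤ.*-identityʳ p)) (sym (ℤ.*-identityʳ q)) p≤q)

fromℤ-cancel : ∀ {p q} → fromℤ p ℚ.≤ fromℤ q → p ℤ.≤ q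
fromℤ-cancel {p} {q} (*≤* le) = subst₂ ℤ._≤_ (ℤ.*-identityʳ p) (ℤ.*-identityʳ q) le

fromℕ : ℕ → ℚ
fromℕ n = fromℤ (ℤ.+ n)

fromℕ-mono : ∀ {m n} → m ≤ n → fromℕ m ℚ.≤ fromℕ n
fromℕ-mono m≤n = fromℤ-mono (ℤ.+≤+ m≤n)

fromℕ-cancel : ∀ {m n} → fromℕ m ℚ.≤ fromℕ n → m ≤ n
fromℕ-cancel le = ℤ.drop‿+≤+ (fromℤ-cancel le)

Meets : ∀ {ℓ} → (Fin ℓ → Interval) → (Fin ℓ → Interval) → Set
Meets f g = ∃[ x ] ∃[ i ] ∃[ j ] (x ∈I f i × x ∈I g j)

module PairIntervals (ℓ : ℕ) (w : List ℕ) where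

  pairInterval : ℕ → Fin ℓ → Interval
  pairInterval a k =
    [ fromℕ (position a (2 * toℕ k) w) , fromℕ (position a (suc (2 * toℕ k)) w) ]⟨
      fromℕ-mono (position-mono a _ w) ⟩

  InPairs⇔Meets : ∀ a b →
    (∃[ t ] (InPairs a w ℓ t × InPairs b w ℓ t)) ⇔ Meets (pairInterval a) (pairInterval b)
  InPairs⇔Meets a b = mk⇔ to from
    where
    inPair : ∀ c t → InPairs c w ℓ t → ∃[ i ] fromℕ t ∈I pairInterval c i
    inPair c t (k , k<ℓ , l1 , l2) rewrite sym (toℕ-fromℕ< k<ℓ) =
      fromℕ< k<ℓ , fromℕ-mono l1 , fromℕ-mono l2
    to : (∃[ t ] (InPairs a w ℓ t × InPairs b w ℓ t)) → Meets (pairInterval a) (pairInterval b)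
    to (t , in-a , in-b) =
      let i , t∈i = inPair a t in-a ; j , t∈j = inPair b t in-b in fromℕ t , i , j , t∈i , t∈j
    -- the later of the two left endpoints lies in both intervals
    from : Meets (pairInterval a) (pairInterval b) → ∃[ t ] (InPairs a w ℓ t × InPairs b w ℓ t)
    from (x , i , j , (lo-i , hi-i) , (lo-j , hi-j))
      with ≤-total (position a (2 * toℕ i) w) (position b (2 * toℕ j) w)
    ... | inj₁ le = position b (2 * toℕ j) w ,
          (toℕ i , toℕ<n i , le , fromℕ-cancel (ℚ.≤-trans lo-j hi-i)) ,
          (toℕ j , toℕ<n j , ≤-refl , position-mono b _ w)
    ... | inj₂ le = position a (2 * toℕ i) w ,
          (toℕ i , toℕ<n i , ≤-refl , position-mono a _ w) ,
          (toℕ j , toℕ<n j , le , fromℕ-cancel (ℚ.≤-trans lo-i hi-j))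

  Lint-h⇔Meets : ∀ a b → a ≢ b → occurrences a w ≡ 2 * ℓ → occurrences b w ≡ 2 * ℓ →
    Lint ℓ (h a b w) ⇔ Meets (pairInterval a) (pairInterval b)
  Lint-h⇔Meets a b a≢b occ-a occ-b =
    ⇔-trans (Lint-h⇔crosses ℓ a b w a≢b occ-a occ-b)
      (⇔-trans (crosses-h⇔InPairs a b w ℓ a≢b occ-a occ-b) (InPairs⇔Meets a b))

point : ℤ → Interval
point z = [ fromℤ z , fromℤ z ]⟨ ℚ.≤-refl ⟩

Meets-sym : ∀ {ℓ} (f g : Fin ℓ → Interval) → Meets f g → Meets g f
Meets-sym f g (x , i , j , x∈fi , x∈gj) = x , j , i , x∈gj , x∈fi

¬Meets-negative-point-pair : ∀ {ℓ} m w b →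
  ¬ Meets (λ (_ : Fin ℓ) → point ℤ.-[1+ m ]) (PairIntervals.pairInterval ℓ w b)
¬Meets-negative-point-pair m w b (x , i , j , (_ , x≤p) , (q≤x , _))
  with fromℤ-cancel (ℚ.≤-trans q≤x x≤p)
... | ()

¬Meets-negative-points : ∀ {ℓ m m′} → m ≢ m′ →
  ¬ Meets (λ (_ : Fin ℓ) → point ℤ.-[1+ m ]) (λ _ → point ℤ.-[1+ m′ ])
¬Meets-negative-points m≢m′ (x , i , j , (p≤x , x≤p) , (q≤x , x≤q))
  with fromℤ-cancel (ℚ.≤-trans p≤x x≤q) | fromℤ-cancel (ℚ.≤-trans q≤x x≤p)
... | ℤ.-≤- m′≤m | ℤ.-≤- m≤m′ = m≢m′ (≤-antisym m≤m′ m′≤m)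

InClass⇒IntervalGraph : ∀ ℓ G → InClass (Lint ℓ) G → IntervalGraph ℓ G
InClass⇒IntervalGraph ℓ G (w , F , F-injective , _ , _ , adj) = intervals , adjacency
  where
  open PairIntervals ℓ w

  -- a vertex whose letter does not occur 2ℓ times is isolated; it gets its own negative point
  intervals : Fin (n G) → Fin ℓ → Interval
  intervals u with occurrences (F u) w ≟ 2 * ℓ
  ... | yes _ = pairInterval (F u)
  ... | no _ = λ _ → point ℤ.-[1+ toℕ u ]

  F-≢ : ∀ {u v} → u ≢ v → F u ≢ F v
  F-≢ u≢v = u≢v ∘ F-injective

  adjacent⇒occurrences : ∀ {u v} (u≢v : u ≢ v) → Adj G u v →
    occurrences (F u) w ≡ 2 * ℓ × occurrences (F v) w ≡ 2 * ℓ
  adjacent⇒occurrences {u} {v} u≢v =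
    Lint-h⇒occurrences ℓ (F u) (F v) w (F-≢ u≢v) ∘ Equivalence.to (adj u v u≢v)

  adjacency : ∀ u v → u ≢ v → Adj G u v ⇔ Meets (intervals u) (intervals v)
  adjacency u v u≢v with occurrences (F u) w ≟ 2 * ℓ | occurrences (F v) w ≟ 2 * ℓ
  ... | yes occ-u | yes occ-v = ⇔-trans (adj u v u≢v) (Lint-h⇔Meets (F u) (F v) (F-≢ u≢v) occ-u occ-v)
  ... | yes _ | no ¬occ-v = mk⇔ (⊥-elim ∘ ¬occ-v ∘ proj₂ ∘ adjacent⇒occurrences u≢v)
                                (⊥-elim ∘ ¬Meets-negative-point-pair (toℕ v) w (F u)
                                          ∘ Meets-sym (pairInterval (F u)) (λ _ → point ℤ.-[1+ toℕ v ]))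
  ... | no ¬occ-u | yes _ = mk⇔ (⊥-elim ∘ ¬occ-u ∘ proj₁ ∘ adjacent⇒occurrences u≢v)
                                (⊥-elim ∘ ¬Meets-negative-point-pair (toℕ u) w (F v))
  ... | no ¬occ-u | no _ = mk⇔ (⊥-elim ∘ ¬occ-u ∘ proj₁ ∘ adjacent⇒occurrences u≢v)
                               (⊥-elim ∘ ¬Meets-negative-points (u≢v ∘ toℕ-injective))

-- From interval representations to words

emit : ∀ {k} → (Fin k → ℕ) → List ℕ
emit {zero} g = []
emit {suc k} g = replicate (g zero) 0 ++ map suc (emit (g ∘ suc))

occurrences-replicate-0 : ∀ m → occurrences 0 (replicate m 0) ≡ m
occurrences-replicate-0 zero = refl
occurrences-replicate-0 (suc m) = cong suc (occurrences-replicate-0 m)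

occurrences-suc-replicate-0 : ∀ a m → occurrences (suc a) (replicate m 0) ≡ 0
occurrences-suc-replicate-0 a zero = refl
occurrences-suc-replicate-0 a (suc m) = occurrences-suc-replicate-0 a m

occurrences-0-map-suc : ∀ w → occurrences 0 (map suc w) ≡ 0
occurrences-0-map-suc [] = refl
occurrences-0-map-suc (x ∷ w) = occurrences-0-map-suc w

occurrences-suc-map-suc : ∀ a w → occurrences (suc a) (map suc w) ≡ occurrences a w
occurrences-suc-map-suc a [] = refl
occurrences-suc-map-suc a (x ∷ w) with x ≟ a | suc x ≟ suc a
... | yes _ | yes _ = cong suc (occurrences-suc-map-suc a w)
... | no _ | no _ = occurrences-suc-map-suc a w
... | yes x≡a | no x≢a = ⊥-elim (x≢a (cong suc x≡a))
... | no x≢a | yes x≡a = ⊥-elim (x≢a (suc-injective x≡a))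

occurrences-emit : ∀ {k} (g : Fin k → ℕ) u → occurrences (toℕ u) (emit g) ≡ g u
occurrences-emit g zero = begin
  occurrences 0 (replicate (g zero) 0 ++ map suc (emit (g ∘ suc)))
    ≡⟨ occurrences-++ 0 (replicate (g zero) 0) _ ⟩
  occurrences 0 (replicate (g zero) 0) + occurrences 0 (map suc (emit (g ∘ suc)))
    ≡⟨ cong₂ _+_ (occurrences-replicate-0 (g zero)) (occurrences-0-map-suc (emit (g ∘ suc))) ⟩
  g zero + 0
    ≡⟨ +-identityʳ (g zero) ⟩
  g zero ∎
  where open ≡-Reasoning
occurrences-emit g (suc u) = begin
  occurrences (suc (toℕ u)) (replicate (g zero) 0 ++ map suc (emit (g ∘ suc)))
    ≡⟨ occurrences-++ (suc (toℕ u)) (replicate (g zero) 0) _ ⟩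
  occurrences (suc (toℕ u)) (replicate (g zero) 0) + occurrences (suc (toℕ u)) (map suc (emit (g ∘ suc)))
    ≡⟨ cong₂ _+_ (occurrences-suc-replicate-0 (toℕ u) (g zero))
                 (occurrences-suc-map-suc (toℕ u) (emit (g ∘ suc))) ⟩
  occurrences (toℕ u) (emit (g ∘ suc))
    ≡⟨ occurrences-emit (g ∘ suc) u ⟩
  g (suc u) ∎
  where open ≡-Reasoning

emit-< : ∀ {k} (g : Fin k → ℕ) → All (_< k) (emit g)
emit-< {zero} g = []
emit-< {suc k} g = All.++⁺ (All.replicate⁺ (g zero) z<s) (All.map⁺ (All.map s<s (emit-< (g ∘ suc))))

Doubled-map : ∀ {A B : Set} (f : A → B) {w} → Doubled w → Doubled (map f w)
Doubled-map f [] = []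
Doubled-map f (dup x d) = dup (f x) (Doubled-map f d)

Doubled-replicate-2* : ∀ {A : Set} m (x : A) → Doubled (replicate (2 * m) x)
Doubled-replicate-2* zero x = []
Doubled-replicate-2* (suc m) x rewrite +-suc m (m + 0) = dup x (Doubled-replicate-2* m x)

Doubled-emit-2* : ∀ {k} (g : Fin k → ℕ) → Doubled (emit (λ u → 2 * g u))
Doubled-emit-2* {zero} g = []
Doubled-emit-2* {suc k} g =
  Doubled-++ (Doubled-replicate-2* (g zero) 0) (Doubled-map suc (Doubled-emit-2* (g ∘ suc)))

opening-table : ∀ p A q B → (A ∧ p) ∧ (B ∧ q) ≡ false →
  crosses (A ∧ p) (B ∧ q) (zeroThenOne (A ∧ not p) (B ∧ not q)) ≡ A ∧ B ×
  crosses (A ∧ p) (B ∧ q) (oneThenZero (A ∧ not p) (B ∧ not q)) ≡ A ∧ B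
opening-table p false q false _ = refl , refl
opening-table p false false true _ = refl , refl
opening-table p false true true _ = refl , refl
opening-table false true q false _ = refl , refl
opening-table true true q false _ = refl , refl
opening-table false true false true _ = refl , refl
opening-table false true true true _ = refl , refl
opening-table true true false true _ = refl , refl
opening-table true true true true ()

closing-table : ∀ A n B m → A ∧ B ≡ false →
  crosses A B (zeroThenOne (A ∧ not n) (B ∧ not m)) ≡ false ×
  crosses A B (oneThenZero (A ∧ not n) (B ∧ not m)) ≡ false
closing-table false n false m _ = refl , refl
closing-table false n true false _ = refl , refl
closing-table false n true true _ = refl , refl
closing-table true false false m _ = refl , refl
closing-table true true false m _ = refl , refl
closing-table true n true m ()

crosses-opening : ∀ p A q B s → count false s ≡ bit (A ∧ not p) → count true s ≡ bit (B ∧ not q) →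
  (A ∧ p) ∧ (B ∧ q) ≡ false → crosses (A ∧ p) (B ∧ q) s ≡ A ∧ B
crosses-opening p A q B s s0 s1 inv with word-with-counts≤1 s _ _ s0 s1
... | inj₁ refl = proj₁ (opening-table p A q B inv)
... | inj₂ refl = proj₂ (opening-table p A q B inv)

crosses-closing : ∀ A n B m c → count false c ≡ bit (A ∧ not n) → count true c ≡ bit (B ∧ not m) →
  A ∧ B ≡ false → crosses A B c ≡ false
crosses-closing A n B m c c0 c1 inv with word-with-counts≤1 c _ _ c0 c1
... | inj₁ refl = proj₁ (closing-table A n B m inv)
... | inj₂ refl = proj₂ (closing-table A n B m inv)

opened-state : ∀ p A {k} → k ≡ bit (A ∧ not p) → (A ∧ p) xor odd k ≡ A
opened-state p false refl = refl
opened-state false true refl = refl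
opened-state true true refl = refl

closed-state : ∀ A n {k} → k ≡ bit (A ∧ not n) → A xor odd k ≡ n ∧ A
closed-state false false refl = refl
closed-state false true refl = refl
closed-state true false refl = refl
closed-state true true refl = refl

∨-absorb : ∀ X {Y Z} → (X ≡ false → Y ≡ false) → X ∨ (Y ∨ Z) ≡ X ∨ Z
∨-absorb true _ = refl
∨-absorb false Y≡false rewrite Y≡false refl = refl

-- One step of the sweep: s opens the pairs of the letters that become active, c closes those
-- that are about to become inactive; p, q say whether they were active before and n, m whether
-- they stay active afterwards.
crosses-block : ∀ p A n q B m s c r →
  count false s ≡ bit (A ∧ not p) → count true s ≡ bit (B ∧ not q) →
  count false c ≡ bit (A ∧ not n) → count true c ≡ bit (B ∧ not m) →
  (A ∧ p) ∧ (B ∧ q) ≡ false →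
  crosses (A ∧ p) (B ∧ q) (s ++ c ++ r) ≡ (A ∧ B) ∨ crosses (n ∧ A) (m ∧ B) r
crosses-block p A n q B m s c r s0 s1 c0 c1 inv = begin
  crosses (A ∧ p) (B ∧ q) (s ++ c ++ r)
    ≡⟨ crosses-++ _ _ s (c ++ r) ⟩
  crosses (A ∧ p) (B ∧ q) s ∨
  crosses ((A ∧ p) xor odd (count false s)) ((B ∧ q) xor odd (count true s)) (c ++ r)
    ≡⟨ cong₂ _∨_ (crosses-opening p A q B s s0 s1 inv)
                 (cong₂ (λ x y → crosses x y (c ++ r)) (opened-state p A s0) (opened-state q B s1)) ⟩
  (A ∧ B) ∨ crosses A B (c ++ r)
    ≡⟨ cong ((A ∧ B) ∨_) (crosses-++ A B c r) ⟩
  (A ∧ B) ∨ (crosses A B c ∨ crosses (A xor odd (count false c)) (B xor odd (count true c)) r)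
    ≡⟨ cong (λ z → (A ∧ B) ∨ (crosses A B c ∨ z))
            (cong₂ (λ x y → crosses x y r) (closed-state A n c0) (closed-state B m c1)) ⟩
  (A ∧ B) ∨ (crosses A B c ∨ crosses (n ∧ A) (m ∧ B) r)
    ≡⟨ ∨-absorb (A ∧ B) (crosses-closing A n B m c c0 c1) ⟩
  (A ∧ B) ∨ crosses (n ∧ A) (m ∧ B) r ∎
  where open ≡-Reasoning

bit-∧-split : ∀ A n p → bit (A ∧ not n) + bit (n ∧ A) ≡ bit (A ∧ not p) + bit (A ∧ p)
bit-∧-split false false p = refl
bit-∧-split false true p = refl
bit-∧-split true false false = refl
bit-∧-split true false true = refl
bit-∧-split true true false = refl
bit-∧-split true true true = refl

+-regroup-2* : ∀ a b c d s → b + c ≡ a + d → a + (b + (2 * s + c)) ≡ 2 * (a + s) + d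
+-regroup-2* a b c d s b+c≡a+d = begin
  a + (b + (2 * s + c)) ≡⟨ solve (a ∷ b ∷ c ∷ s ∷ []) ⟩
  a + 2 * s + (b + c)   ≡⟨ cong (a + 2 * s +_) b+c≡a+d ⟩
  a + 2 * s + (a + d)   ≡⟨ solve (a ∷ d ∷ s ∷ []) ⟩
  2 * (a + s) + d       ∎
  where open ≡-Reasoning

odd-2* : ∀ n → odd (2 * n) ≡ false
odd-2* zero = refl
odd-2* (suc n) rewrite +-suc n (n + 0) = trans (not-involutive _) (odd-2* n)

∨-cong-false : ∀ X {Y Z} → (X ≡ false → Y ≡ Z) → X ∨ Y ≡ X ∨ Z
∨-cong-false true _ = refl
∨-cong-false false Y≡Z = cong (false ∨_) (Y≡Z refl)

∧-disjoint : ∀ n A m B → A ∧ B ≡ false → (n ∧ A) ∧ (m ∧ B) ≡ false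
∧-disjoint false A m B _ = refl
∧-disjoint true A false B _ = ∧-zeroʳ A
∧-disjoint true A true B A∧B≡false = A∧B≡false

occurrences>0⇒∈ : ∀ a w → 0 < occurrences a w → a ∈ w
occurrences>0⇒∈ a (x ∷ w) pos with x ≟ a
... | yes x≡a = here (sym x≡a)
... | no _ = there (occurrences>0⇒∈ a w pos)

_∈I?_ : ∀ x I → Dec (x ∈I I)
x ∈I? I = (lo I ℚ.≤? x) ×-dec (x ℚ.≤? hi I)

module Sweep (ℓ N : ℕ) (f : Fin N → Fin ℓ → Interval) where

  active : Fin N → ℚ → Bool
  active v x = does (any? λ i → x ∈I? f v i)

  active⇒ : ∀ {v x} → active v x ≡ true → ∃[ i ] x ∈I f v i
  active⇒ {v} {x} e with any? (λ i → x ∈I? f v i)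
  ... | yes found = found
  active⇒ {v} {x} () | no _

  ⇒active : ∀ {v x} i → x ∈I f v i → active v x ≡ true
  ⇒active {v} {x} i x∈i = dec-true (any? λ i → x ∈I? f v i) (i , x∈i)

  next : List ℚ → Fin N → Bool
  next [] v = false
  next (y ∷ _) v = active v y

  sweep : (Fin N → Bool) → List ℚ → List ℕ
  sweep prev [] = []
  sweep prev (x ∷ xs) =
    emit (λ v → bit (active v x ∧ not (prev v))) ++
    emit (λ v → bit (active v x ∧ not (next xs v))) ++
    sweep (λ v → active v x) xs

  openings : Fin N → Bool → List ℚ → ℕ
  openings v p [] = 0
  openings v p (x ∷ xs) = bit (active v x ∧ not p) + openings v (active v x) xs

  sweep-< : ∀ prev xs → All (_< N) (sweep prev xs)
  sweep-< prev [] = []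
  sweep-< prev (x ∷ xs) = All.++⁺ (emit-< _) (All.++⁺ (emit-< _) (sweep-< _ xs))

  occurrences-sweep : ∀ v prev xs →
    occurrences (toℕ v) (sweep prev xs) ≡ 2 * openings v (prev v) xs + bit (next xs v ∧ prev v)
  occurrences-sweep v prev [] = refl
  occurrences-sweep v prev (x ∷ xs) = begin
    occurrences (toℕ v) (O ++ C ++ R)
      ≡⟨ occurrences-++ (toℕ v) O (C ++ R) ⟩
    occurrences (toℕ v) O + occurrences (toℕ v) (C ++ R)
      ≡⟨ cong (occurrences (toℕ v) O +_) (occurrences-++ (toℕ v) C R) ⟩
    occurrences (toℕ v) O + (occurrences (toℕ v) C + occurrences (toℕ v) R)
      ≡⟨ cong₂ _+_ (occurrences-emit _ v) (cong₂ _+_ (occurrences-emit _ v) (occurrences-sweep v _ xs)) ⟩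
    bit (A ∧ not (prev v)) + (bit (A ∧ not (next xs v)) + (2 * openings v A xs + bit (next xs v ∧ A)))
      ≡⟨ +-regroup-2* (bit (A ∧ not (prev v))) (bit (A ∧ not (next xs v)))
                 (bit (next xs v ∧ A)) (bit (A ∧ prev v))
                 (openings v A xs) (bit-∧-split A (next xs v) (prev v)) ⟩
    2 * openings v (prev v) (x ∷ xs) + bit (A ∧ prev v) ∎
    where
    open ≡-Reasoning
    A = active v x
    O = emit (λ v → bit (active v x ∧ not (prev v)))
    C = emit (λ v → bit (active v x ∧ not (next xs v)))
    R = sweep (λ v → active v x) xs

  occurrences-sweep₀ : ∀ v xs → occurrences (toℕ v) (sweep (λ _ → false) xs) ≡ 2 * openings v false xs
  occurrences-sweep₀ v xs =
    trans (occurrences-sweep v (λ _ → false) xs)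
          (trans (cong (λ b → 2 * openings v false xs + bit b) (∧-zeroʳ (next xs v))) (+-identityʳ _))

  -- The intervals of v that contain an opening point are pairwise distinct, and S collects them;
  -- p records whether v is active at the last point y.
  openings≤′ : ∀ v (S : Subset ℓ) y p xs →
    (∀ i → i ∈ˢ S → lo (f v i) ℚ.≤ y × active v y ≡ p) → Linked ℚ._≤_ (y ∷ xs) →
    ∣ S ∣ + openings v p xs ≤ ℓ
  openings≤′ v S y p [] _ _ = ≤-trans (≤-reflexive (+-identityʳ _)) (∣p∣≤n S)
  openings≤′ v S y p (x ∷ xs) inv (y≤x Linked.∷ sorted) with active v x in act-x | p
  ... | false | _ =
    openings≤′ v S x false xs (λ i i∈S → ℚ.≤-trans (proj₁ (inv i i∈S)) y≤x , act-x) sorted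
  ... | true | true =
    openings≤′ v S x true xs (λ i i∈S → ℚ.≤-trans (proj₁ (inv i i∈S)) y≤x , act-x) sorted
  ... | true | false with active⇒ act-x
  ...   | i , x∈i@(lo≤x , x≤hi) =
    ≤-trans (≤-reflexive (+-suc ∣ S ∣ _))
            (≤-trans (+-monoˡ-≤ (openings v true xs) ∣S∣<∣S′∣) (openings≤′ v S′ x true xs inv′ sorted))
    where
    S′ = ⁅ i ⁆ ∪ S
    i∉S : i ∉ˢ S
    i∉S i∈S with inv i i∈S
    ... | lo≤y , act-y with trans (sym (⇒active i (lo≤y , ℚ.≤-trans y≤x x≤hi))) act-y
    ...   | ()
    ∣S∣<∣S′∣ : ∣ S ∣ < ∣ S′ ∣
    ∣S∣<∣S′∣ = p⊂q⇒∣p∣<∣q∣ (q⊆p∪q ⁅ i ⁆ S , i , x∈p∪q⁺ (inj₁ (x∈⁅x⁆ i)) , i∉S)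
    inv′ : ∀ j → j ∈ˢ S′ → lo (f v j) ℚ.≤ x × active v x ≡ true
    inv′ j j∈S′ with x∈p∪q⁻ ⁅ i ⁆ S j∈S′
    ... | inj₁ j∈⁅i⁆ rewrite x∈⁅y⁆⇒x≡y i j∈⁅i⁆ = lo≤x , act-x
    ... | inj₂ j∈S = ℚ.≤-trans (proj₁ (inv j j∈S)) y≤x , act-x

  openings≤ : ∀ v xs → Linked ℚ._≤_ xs → openings v false xs ≤ ℓ
  openings≤ v [] _ = z≤n
  openings≤ v (x ∷ xs) sorted =
    subst (λ k → k + openings v false (x ∷ xs) ≤ ℓ) (∣⊥∣≡0 ℓ)
          (openings≤′ v ∅ x false (x ∷ xs) (λ i i∈∅ → ⊥-elim (∉⊥ i∈∅)) (ℚ.≤-refl Linked.∷ sorted))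

  coactiveAt : Fin N → Fin N → List ℚ → Bool
  coactiveAt u v [] = false
  coactiveAt u v (x ∷ xs) = (active u x ∧ active v x) ∨ coactiveAt u v xs

  crosses-sweep : ∀ u v → toℕ u ≢ toℕ v → ∀ prev xs →
    (next xs u ∧ prev u) ∧ (next xs v ∧ prev v) ≡ false →
    crosses (next xs u ∧ prev u) (next xs v ∧ prev v) (h (toℕ u) (toℕ v) (sweep prev xs))
      ≡ coactiveAt u v xs
  crosses-sweep u v u≢v prev [] _ = refl
  crosses-sweep u v u≢v prev (x ∷ xs) inv = begin
    crosses (Au ∧ prev u) (Av ∧ prev v) (h a b (O ++ C ++ R))
      ≡⟨ cong (crosses _ _) (trans (h-++ a b O (C ++ R)) (cong (h a b O ++_) (h-++ a b C R))) ⟩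
    crosses (Au ∧ prev u) (Av ∧ prev v) (h a b O ++ h a b C ++ h a b R)
      ≡⟨ crosses-block (prev u) Au (next xs u) (prev v) Av (next xs v) (h a b O) (h a b C) (h a b R)
                       (trans (count-false-h a b O) (occurrences-emit _ u))
                       (trans (count-true-h a b O u≢v) (occurrences-emit _ v))
                       (trans (count-false-h a b C) (occurrences-emit _ u))
                       (trans (count-true-h a b C u≢v) (occurrences-emit _ v)) inv ⟩
    (Au ∧ Av) ∨ crosses (next xs u ∧ Au) (next xs v ∧ Av) (h a b R)
      ≡⟨ ∨-cong-false (Au ∧ Av) (λ Au∧Av≡false →
           crosses-sweep u v u≢v (λ w → active w x) xs
                         (∧-disjoint (next xs u) Au (next xs v) Av Au∧Av≡false)) ⟩
    (Au ∧ Av) ∨ coactiveAt u v xs ∎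
    where
    open ≡-Reasoning
    a = toℕ u
    b = toℕ v
    Au = active u x
    Av = active v x
    O = emit (λ w → bit (active w x ∧ not (prev w)))
    C = emit (λ w → bit (active w x ∧ not (next xs w)))
    R = sweep (λ w → active w x) xs

  -- doubled letters pad every vertex to exactly ℓ pairs without creating crossings
  word : List ℚ → List ℕ
  word xs = sweep (λ _ → false) xs ++ emit (λ v → 2 * (ℓ ∸ openings v false xs))

  word-< : ∀ xs → All (_< N) (word xs)
  word-< xs = All.++⁺ (sweep-< _ xs) (emit-< _)

  occurrences-word : ∀ xs → Linked ℚ._≤_ xs → ∀ v → occurrences (toℕ v) (word xs) ≡ 2 * ℓ
  occurrences-word xs sorted v = begin
    occurrences (toℕ v) (word xs)
      ≡⟨ occurrences-++ (toℕ v) (sweep (λ _ → false) xs) _ ⟩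
    occurrences (toℕ v) (sweep (λ _ → false) xs) +
    occurrences (toℕ v) (emit (λ w → 2 * (ℓ ∸ openings w false xs)))
      ≡⟨ cong₂ _+_ (occurrences-sweep₀ v xs) (occurrences-emit _ v) ⟩
    2 * openings v false xs + 2 * (ℓ ∸ openings v false xs)
      ≡⟨ sym (*-distribˡ-+ 2 (openings v false xs) _) ⟩
    2 * (openings v false xs + (ℓ ∸ openings v false xs))
      ≡⟨ cong (2 *_) (m+[n∸m]≡n (openings≤ v xs sorted)) ⟩
    2 * ℓ ∎
    where open ≡-Reasoning

  crosses-word : ∀ u v → toℕ u ≢ toℕ v → ∀ xs →
    crosses false false (h (toℕ u) (toℕ v) (word xs)) ≡ coactiveAt u v xs
  crosses-word u v u≢v xs = begin
    crosses false false (h a b (S ++ P))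
      ≡⟨ cong (crosses false false) (h-++ a b S P) ⟩
    crosses false false (h a b S ++ h a b P)
      ≡⟨ crosses-++ false false (h a b S) (h a b P) ⟩
    crosses false false (h a b S) ∨ crosses (odd (count false (h a b S))) (odd (count true (h a b S))) (h a b P)
      ≡⟨ cong₂ _∨_ crosses-S (cong₂ (λ p q → crosses p q (h a b P)) (S-even-false) (S-even-true)) ⟩
    coactiveAt u v xs ∨ crosses false false (h a b P)
      ≡⟨ cong (coactiveAt u v xs ∨_)
              (Doubled⇒¬crosses (Doubled-h a b (Doubled-emit-2* (λ w → ℓ ∸ openings w false xs)))) ⟩
    coactiveAt u v xs ∨ false
      ≡⟨ ∨-identityʳ _ ⟩
    coactiveAt u v xs ∎
    where
    open ≡-Reasoning
    a = toℕ u
    b = toℕ v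
    S = sweep (λ _ → false) xs
    P = emit (λ v → 2 * (ℓ ∸ openings v false xs))
    crosses-S : crosses false false (h a b S) ≡ coactiveAt u v xs
    crosses-S = subst₂ (λ p q → crosses p q (h a b S) ≡ coactiveAt u v xs)
                       (∧-zeroʳ (next xs u)) (∧-zeroʳ (next xs v))
                       (crosses-sweep u v u≢v (λ _ → false) xs (cong (_∧ _) (∧-zeroʳ (next xs u))))
    S-even-false : odd (count false (h a b S)) ≡ false
    S-even-false =
      trans (cong odd (trans (count-false-h a b S) (occurrences-sweep₀ u xs))) (odd-2* (openings u false xs))
    S-even-true : odd (count true (h a b S)) ≡ false
    S-even-true =
      trans (cong odd (trans (count-true-h a b S u≢v) (occurrences-sweep₀ v xs))) (odd-2* (openings v false xs))

  coactiveAt-∈ : ∀ u v {y} xs → y ∈ xs → active u y ≡ true → active v y ≡ true →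
    coactiveAt u v xs ≡ true
  coactiveAt-∈ u v (x ∷ xs) (here refl) act-u act-v rewrite act-u | act-v = refl
  coactiveAt-∈ u v (x ∷ xs) (there y∈xs) act-u act-v =
    ∨≡trueʳ (active u x ∧ active v x) (coactiveAt-∈ u v xs y∈xs act-u act-v)

  coactiveAt⇔Meets : ∀ u v xs → (∀ w i → lo (f w i) ∈ xs) →
    coactiveAt u v xs ≡ true ⇔ Meets (f u) (f v)
  coactiveAt⇔Meets u v xs lo∈xs = mk⇔ (to xs) from
    where
    to : ∀ xs → coactiveAt u v xs ≡ true → Meets (f u) (f v)
    to (x ∷ xs) e with ∨≡true⁻ {active u x ∧ active v x} e
    ... | inj₂ later = to xs later
    ... | inj₁ now with ∧≡true⁻ now
    ...   | act-u , act-v = let i , x∈i = active⇒ act-u ; j , x∈j = active⇒ act-v in x , i , j , x∈i , x∈j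
    -- the later of the two left endpoints is a sample point in both intervals
    from : Meets (f u) (f v) → coactiveAt u v xs ≡ true
    from (x , i , j , (lo-i≤x , x≤hi-i) , (lo-j≤x , x≤hi-j)) with ℚ.≤-total (lo (f u i)) (lo (f v j))
    ... | inj₁ lo-i≤lo-j = coactiveAt-∈ u v xs (lo∈xs v j)
          (⇒active i (lo-i≤lo-j , ℚ.≤-trans lo-j≤x x≤hi-i)) (⇒active j (ℚ.≤-refl , lo≤hi (f v j)))
    ... | inj₂ lo-j≤lo-i = coactiveAt-∈ u v xs (lo∈xs u i)
          (⇒active i (ℚ.≤-refl , lo≤hi (f u i))) (⇒active j (lo-j≤lo-i , ℚ.≤-trans lo-i≤x x≤hi-j))

IntervalGraph⇒InClass : ∀ ℓ → 1 ≤ ℓ → ∀ G → IntervalGraph ℓ G → InClass (Lint ℓ) G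
IntervalGraph⇒InClass ℓ 1≤ℓ G (f , meets) =
  word points , toℕ , toℕ-injective , vertex∈word , letter-is-vertex , adjacency
  where
  open Sweep ℓ (n G) f

  leftEndpoints : List ℚ
  leftEndpoints = concat (tabulate λ v → tabulate λ i → lo (f v i))

  points : List ℚ
  points = sort leftEndpoints

  lo∈points : ∀ v i → lo (f v i) ∈ points
  lo∈points v i =
    ∈-resp-↭ (↭-sym (sort-↭ leftEndpoints)) (∈-concat⁺′ (∈-tabulate⁺ i) (∈-tabulate⁺ v))

  occurrences≡2ℓ : ∀ v → occurrences (toℕ v) (word points) ≡ 2 * ℓ
  occurrences≡2ℓ = occurrences-word points (sort-↗ leftEndpoints)

  vertex∈word : ∀ v → toℕ v ∈ word points
  vertex∈word v = occurrences>0⇒∈ (toℕ v) (word points)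
    (subst (0 <_) (sym (occurrences≡2ℓ v)) (≤-trans 1≤ℓ (m≤m+n ℓ (ℓ + 0))))

  letter-is-vertex : ∀ x → x ∈ word points → ∃[ v ] toℕ v ≡ x
  letter-is-vertex x x∈word = fromℕ< x<n , toℕ-fromℕ< x<n
    where x<n = All.lookup (word-< points) x∈word

  adjacency : ∀ u v → u ≢ v → Adj G u v ⇔ Lint ℓ (h (toℕ u) (toℕ v) (word points))
  adjacency u v u≢v =
    ⇔-trans (meets u v u≢v)
    (⇔-trans (⇔-sym (coactiveAt⇔Meets u v points lo∈points))
    (⇔-trans (mk⇔ (trans crosses≡coactive) (trans (sym crosses≡coactive)))
             (⇔-sym (Lint-h⇔crosses ℓ (toℕ u) (toℕ v) (word points) toℕu≢toℕv
                                    (occurrences≡2ℓ u) (occurrences≡2ℓ v)))))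
    where
    toℕu≢toℕv : toℕ u ≢ toℕ v
    toℕu≢toℕv = u≢v ∘ toℕ-injective
    crosses≡coactive = crosses-word u v toℕu≢toℕv points

theorem2 : (ℓ : ℕ) → 1 ≤ ℓ →
    UniformLang (2 * ℓ) (Lint ℓ) ×
    ((G : Graph) → (InClass (Lint ℓ) G ⇔ IntervalGraph ℓ G))
theorem2 ℓ 1≤ℓ =
  (λ w (c0 , c1 , _) → c0 , c1) ,
  (λ G → mk⇔ (InClass⇒IntervalGraph ℓ G) (IntervalGraph⇒InClass ℓ 1≤ℓ G))
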